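{- Let $G$ be a finite connected multigraph, $q\in V(G)$, and let $E\in\operatorname{Div}(G)$ be orientable but not $q$-orientable. If $S_1,S_2\in\mathbf S_q(E)$, then $S_1\cup S_2\in\mathbf S_q(E)$. In particular, $\mathbf S_q(E)$ has a unique maximal element with respect to inclusion.
   Context: $\operatorname{Div}(G)$ is the free abelian group on $V(G)$. For $S\subseteq V(G)$, $e(S)$ is the number of edges with both endpoints in $S$ and $\chi(S,E)=\deg(E|_S)+|S|-e(S)$. Let $\chi_E=\min\{\chi(S,E):\emptyset\neq S\subsetneq V(G)\}$ and $\mathbf S_q(E)=\{S:\emptyset\ne S\subseteq V(G)\setminus\{q\},\ \chi(S,E)=\chi_E\}$. $E$ is orientable if there is an orientation $\mathcal O$ of the edges with $E(p)=\mathrm{indeg}_{\mathcal O}(p)-1$ at every vertex $p$, and $q$-orientable if such an orientation can be chosen with a directed path from $q$ to every vertex. -}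

module Defs where

open import Data.Nat using (ℕ; zero; suc)
open import Data.Integer using (ℤ; +_; _+_; _-_; 0ℤ; 1ℤ)
open import Data.Bool using (Bool; true; false; _∧_; if_then_else_)
open import Data.Fin using (Fin; _≟_)
open import Data.Fin.Subset using (Subset; _∈_; _∉_; _⊆_; _∪_; Nonempty)
open import Data.Vec using (lookup)
open import Data.List using (List; []; _∷_; allFin; foldr; filter; length)
open import Data.List.Relation.Unary.All using (All)
open import Data.List.Relation.Binary.Pointwise using (Pointwise)
import Data.List.Membership.Propositional as Mem
open import Data.Product using (Σ; _×_; _,_; proj₁; proj₂; ∃)
open import Data.Sum using (_⊎_)
open import Relation.Binary.PropositionalEquality using (_≡_; _≢_)
open import Relation.Binary.Construct.Closure.ReflexiveTransitive using (Star)

-- A finite multigraph on vertex set Fin n: a list of edges (multiple edges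
-- allowed, given by repeated entries); loopless.
record Multigraph : Set where
  field
    n        : ℕ
    edges    : List (Fin n × Fin n)
    loopless : All (λ e → proj₁ e ≢ proj₂ e) edges
open Multigraph public

Adj : (G : Multigraph) → Fin (n G) → Fin (n G) → Set
Adj G u v = (Mem._∈_ (u , v) (edges G)) ⊎ (Mem._∈_ (v , u) (edges G))

Connected : Multigraph → Set
Connected G = ∀ u v → Star (Adj G) u v

Div : Multigraph → Set
Div G = Fin (n G) → ℤ

degRestr : (G : Multigraph) → Div G → Subset (n G) → ℤ
degRestr G E S = foldr (λ v acc → (if lookup S v then E v else 0ℤ) + acc) 0ℤ (allFin (n G))

card : ∀ {m} → Subset m → ℕ
card {m} S = foldr (λ v acc → if lookup S v then suc acc else acc) 0 (allFin m)

eIn : (G : Multigraph) → Subset (n G) → ℕ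
eIn G S = foldr (λ e acc → if (lookup S (proj₁ e) ∧ lookup S (proj₂ e)) then suc acc else acc) 0 (edges G)

χ : (G : Multigraph) → Subset (n G) → Div G → ℤ
χ G S E = (degRestr G E S + (+ card S)) - (+ eIn G S)

NonemptyProper : ∀ {m} → Subset m → Set
NonemptyProper {m} S = Nonempty S × (∃ λ (v : Fin m) → v ∉ S)

-- χ(S,E) = χ_E, where χ_E is the minimum of χ(T,E) over ∅ ≠ T ⊊ V(G):
-- S is in the index set and attains the minimum.
AttainsχE : (G : Multigraph) → Div G → Subset (n G) → Set
AttainsχE G E S = NonemptyProper S × (∀ T → NonemptyProper T → χ G S E Data.Integer.≤ χ G T E)

InSq : (G : Multigraph) → Fin (n G) → Div G → Subset (n G) → Set
InSq G q E S = Nonempty S × q ∉ S × AttainsχE G E S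

-- An orientation of G: a list of arcs, the i-th arc being the i-th edge
-- with one of its two directions.
IsOrientation : (G : Multigraph) → List (Fin (n G) × Fin (n G)) → Set
IsOrientation G D = Pointwise (λ e d → d ≡ e ⊎ d ≡ (proj₂ e , proj₁ e)) (edges G) D

indeg : ∀ {m} → List (Fin m × Fin m) → Fin m → ℕ
indeg D p = length (filter (λ d → proj₂ d ≟ p) D)

Realizes : (G : Multigraph) → Div G → List (Fin (n G) × Fin (n G)) → Set
Realizes G E D = IsOrientation G D × (∀ p → E p ≡ (+ indeg D p) - 1ℤ)

Orientable : (G : Multigraph) → Div G → Set
Orientable G E = ∃ λ D → Realizes G E D

DirPath : ∀ {m} → List (Fin m × Fin m) → Fin m → Fin m → Set
DirPath D = Star (λ a b → Mem._∈_ (a , b) D)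

QOrientable : (G : Multigraph) → Fin (n G) → Div G → Set
QOrientable G q E = ∃ λ D → Realizes G E D × (∀ v → DirPath D q v)

MaximalInSq : (G : Multigraph) → Fin (n G) → Div G → Subset (n G) → Set
MaximalInSq G q E S = InSq G q E S × (∀ T → InSq G q E T → S ⊆ T → T ≡ S)

-- For any orientation D realising E, χ(S,E) counts the arcs of D entering S, so χ ≥ 0.
-- The vertices not reachable from q in D form a set M which no arc enters; M is nonempty
-- since E is not q-orientable, so χ_E = 0 and 𝐒_q(E) consists of the nonempty sets
-- avoiding q that no arc enters. Such sets are closed under union, and each lies in M
-- (a path from q to one of its vertices would have to start inside it), so M is the greatest element.
module Submission where

open import Defs
open import Data.Bool using (Bool; true; false; _∧_; not; if_then_else_)
open import Data.Bool.Properties using (if-eta; if-float; not-injective)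
open import Data.Fin using (Fin; zero; suc; _≟_)
open import Data.Fin.Subset
  using (Subset; _∈_; _∉_; _⊆_; _⊂_; _∪_; ∁; ⁅_⁆; ∣_∣; Nonempty)
open import Data.Fin.Subset.Properties
  using ( _∈?_; nonempty?; ⊆-antisym; p⊆p∪q; q⊆p∪q; x∈p∪q⁺; x∈p∪q⁻; x∈⁅x⁆; x∈⁅y⁆⇒x≡y
        ; ∣⁅x⁆∣≡1; ∣p∣≤n; p⊂q⇒∣p∣<∣q∣; x∈p⇒x∉∁p; x∉p⇒x∈∁p; x∈∁p⇒x∉p)
open import Data.Integer as ℤ using (ℤ; +_; 0ℤ; 1ℤ; +≤+)
import Data.Integer.Properties as ℤₚ
open import Data.Integer.Tactic.RingSolver using (solve-∀)
open import Data.List using (List; []; _∷_; foldr; tabulate; allFin)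
open import Data.List.Membership.Propositional using (find; lose) renaming (_∈_ to _∈ₗ_)
open import Data.List.Relation.Unary.Any using (here; there; any?)
open import Data.List.Relation.Binary.Pointwise using (Pointwise; []; _∷_)
open import Data.Nat using (ℕ; zero; suc; _+_; _≤_; _<_; z≤n; s≤s)
import Data.Nat.Properties as ℕₚ
open import Algebra.Properties.CommutativeMonoid.Sum ℕₚ.+-0-commutativeMonoid
  using (sum-syntax; ∑-distrib-+; sum-cong-≗; sum-replicate-zero)
open import Data.Product using (_×_; _,_; ∃; ∃₂; proj₁; proj₂)
open import Data.Sum using (_⊎_; inj₁; inj₂)
open import Data.Vec using (lookup)
open import Data.Vec.Properties using ([]=⇒lookup; lookup⇒[]=)
open import Function using (_∘_; _⇔_; mk⇔; Equivalence)
open import Relation.Nullary using (¬_; yes; no; does; ¬?; contradiction)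
open import Relation.Nullary.Decidable using (_×-dec_; decidable-stable)
open import Relation.Binary.PropositionalEquality
  using (_≡_; refl; sym; trans; cong; cong₂; subst; module ≡-Reasoning)
open import Relation.Binary.Construct.Closure.ReflexiveTransitive using (ε; _◅_; _◅◅_)
open import Algebra.Properties.AbelianGroup ℤₚ.+-0-abelianGroup using (xyx⁻¹≈y)

-- card and eIn of Defs are instances of count.
count : {A : Set} → (A → Bool) → List A → ℕ
count p = foldr (λ x k → if p x then suc k else k) 0

count≡0⇒false : ∀ {A : Set} (p : A → Bool) xs → count p xs ≡ 0 → ∀ {x} → x ∈ₗ xs → p x ≡ false
count≡0⇒false p (y ∷ xs) c≡0 (here refl) with p y
... | false = refl
count≡0⇒false p (y ∷ xs) c≡0 (there x∈xs) with p y
... | false = count≡0⇒false p xs c≡0 x∈xs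

false⇒count≡0 : ∀ {A : Set} (p : A → Bool) xs → (∀ {x} → x ∈ₗ xs → p x ≡ false) → count p xs ≡ 0
false⇒count≡0 p []       _        = refl
false⇒count≡0 p (y ∷ xs) allFalse rewrite allFalse (here refl) = false⇒count≡0 p xs (allFalse ∘ there)

foldr-tabulate : ∀ {A : Set} {k} (g : A → ℕ) (f : Fin k → A) →
                 foldr (λ x acc → g x + acc) 0 (tabulate f) ≡ ∑[ i < k ] g (f i)
foldr-tabulate {k = zero}  g f = refl
foldr-tabulate {k = suc k} g f = cong (_+_ (g (f zero))) (foldr-tabulate g (f ∘ suc))

∑-δ : ∀ {k} (s : Fin k → Bool) (h : Fin k) →
      ∑[ v < k ] (if s v then (if does (h ≟ v) then 1 else 0) else 0) ≡ (if s h then 1 else 0)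
∑-δ {suc k} s zero = trans (cong (_+_ _) rest≡0) (ℕₚ.+-identityʳ _)
  where rest≡0 = trans (sum-cong-≗ (λ v → if-eta (s (suc v)))) (sum-replicate-zero k)
∑-δ {suc k} s (suc h) rewrite if-eta (s zero) {0} = ∑-δ (s ∘ suc) h

module _ {m : ℕ} (S : Subset m) where

  bothIn headIn entering : Fin m × Fin m → Bool
  bothIn   (u , v) = lookup S u ∧ lookup S v
  headIn   (u , v) = lookup S v
  entering (u , v) = lookup S v ∧ not (lookup S u)

  inside+entering≡heads : ∀ {es ds} → Pointwise (λ e d → d ≡ e ⊎ d ≡ (proj₂ e , proj₁ e)) es ds →
                          count bothIn es + count entering ds ≡ count headIn ds
  inside+entering≡heads [] = refl
  inside+entering≡heads {(a , b) ∷ _} (inj₁ refl ∷ rest) with lookup S a | lookup S b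
  ... | true  | true  = cong suc (inside+entering≡heads rest)
  ... | true  | false = inside+entering≡heads rest
  ... | false | true  = trans (ℕₚ.+-suc _ _) (cong suc (inside+entering≡heads rest))
  ... | false | false = inside+entering≡heads rest
  inside+entering≡heads {(a , b) ∷ _} (inj₂ refl ∷ rest) with lookup S a | lookup S b
  ... | true  | true  = cong suc (inside+entering≡heads rest)
  ... | true  | false = trans (ℕₚ.+-suc _ _) (cong suc (inside+entering≡heads rest))
  ... | false | true  = inside+entering≡heads rest
  ... | false | false = inside+entering≡heads rest

  degIn : (Fin m → ℤ) → List (Fin m) → ℤ
  degIn E = foldr (λ v acc → (if lookup S v then E v else 0ℤ) ℤ.+ acc) 0ℤ

  weightIn : (Fin m → ℕ) → List (Fin m) → ℕ
  weightIn w = foldr (λ v acc → (if lookup S v then w v else 0) + acc) 0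

  deg+card≡weight : (E : Fin m → ℤ) (w : Fin m → ℕ) → (∀ v → E v ≡ + w v ℤ.- 1ℤ) →
                    ∀ xs → degIn E xs ℤ.+ + count (lookup S) xs ≡ + weightIn w xs
  deg+card≡weight E w E≡w-1 [] = refl
  deg+card≡weight E w E≡w-1 (v ∷ xs) with lookup S v | deg+card≡weight E w E≡w-1 xs
  ... | false | ih = trans (cong (ℤ._+ + count (lookup S) xs) (ℤₚ.+-identityˡ (degIn E xs))) ih
  ... | true  | ih rewrite E≡w-1 v =
    trans (shuffle (+ w v) _ _) (trans (cong (ℤ._+_ (+ w v)) ih) (sym (ℤₚ.pos-+ (w v) _)))
    where
    shuffle : ∀ a b c → ((a ℤ.- 1ℤ) ℤ.+ b) ℤ.+ (1ℤ ℤ.+ c) ≡ a ℤ.+ (b ℤ.+ c)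
    shuffle = solve-∀

  indeg-∷ : ∀ (d : Fin m × Fin m) D v → indeg (d ∷ D) v ≡ (if does (proj₂ d ≟ v) then 1 else 0) + indeg D v
  indeg-∷ d D v with does (proj₂ d ≟ v)
  ... | true  = refl
  ... | false = refl

  ∑-indeg≡heads : ∀ D → ∑[ v < m ] (if lookup S v then indeg D v else 0) ≡ count headIn D
  ∑-indeg≡heads [] = trans (sum-cong-≗ (λ v → if-eta (lookup S v))) (sum-replicate-zero m)
  ∑-indeg≡heads (d ∷ D) = begin
      ∑[ v < m ] (if lookup S v then indeg (d ∷ D) v else 0)
    ≡⟨ sum-cong-≗ split ⟩
      ∑[ v < m ] (δ v + (if lookup S v then indeg D v else 0))
    ≡⟨ ∑-distrib-+ δ _ ⟩
      ∑[ v < m ] δ v + ∑[ v < m ] (if lookup S v then indeg D v else 0)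
    ≡⟨ cong₂ _+_ (∑-δ (lookup S) (proj₂ d)) (∑-indeg≡heads D) ⟩
      (if headIn d then 1 else 0) + count headIn D
    ≡⟨ if-float (_+ count headIn D) (headIn d) ⟩
      count headIn (d ∷ D)
    ∎
    where
    open ≡-Reasoning
    δ : Fin m → ℕ
    δ v = if lookup S v then (if does (proj₂ d ≟ v) then 1 else 0) else 0
    split : ∀ v → (if lookup S v then indeg (d ∷ D) v else 0) ≡ δ v + (if lookup S v then indeg D v else 0)
    split v with lookup S v
    ... | true  = indeg-∷ d D v
    ... | false = refl

χ≡entering : ∀ G {E D} → Realizes G E D → ∀ S → χ G S E ≡ + count (entering S) D
χ≡entering G {E} {D} (orientation , E≡indeg-1) S = begin
    (degRestr G E S ℤ.+ + card S) ℤ.- + eIn G S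
  ≡⟨ cong (ℤ._- + eIn G S) heads ⟩
    + count (headIn S) D ℤ.- + eIn G S
  ≡⟨ cong (λ k → + k ℤ.- + eIn G S) (sym (inside+entering≡heads S orientation)) ⟩
    + (eIn G S + count (entering S) D) ℤ.- + eIn G S
  ≡⟨ cong (ℤ._- + eIn G S) (ℤₚ.pos-+ (eIn G S) _) ⟩
    (+ eIn G S ℤ.+ + count (entering S) D) ℤ.- + eIn G S
  ≡⟨ xyx⁻¹≈y (+ eIn G S) _ ⟩
    + count (entering S) D
  ∎
  where
  open ≡-Reasoning
  heads : degRestr G E S ℤ.+ + card S ≡ + count (headIn S) D
  heads = trans (deg+card≡weight S E (indeg D) E≡indeg-1 (allFin (n G)))
                (cong +_ (trans (foldr-tabulate (λ v → if lookup S v then indeg D v else 0) (λ v → v))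
                                 (∑-indeg≡heads S D)))

entering≡false⇒ : ∀ {m} (S : Subset m) {u v} → entering S (u , v) ≡ false → v ∈ S → u ∈ S
entering≡false⇒ S {u} {v} notEntering v∈S =
  lookup⇒[]= u S (not-injective (subst (λ b → b ∧ not (lookup S u) ≡ false) ([]=⇒lookup v∈S) notEntering))

entering≡false⇐ : ∀ {m} (S : Subset m) {u v} → (v ∈ S → u ∈ S) → entering S (u , v) ≡ false
entering≡false⇐ S {u} {v} closed with lookup S v in lookup≡
... | false = refl
... | true rewrite []=⇒lookup (closed (lookup⇒[]= v S lookup≡)) = refl

⊂-∪-⁅⁆ : ∀ {m} {R : Subset m} {v} → v ∉ R → R ⊂ R ∪ ⁅ v ⁆
⊂-∪-⁅⁆ {v = v} v∉R = p⊆p∪q ⁅ v ⁆ , v , x∈p∪q⁺ (inj₂ (x∈⁅x⁆ v)) , v∉R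

module _ {m : ℕ} (D : List (Fin m × Fin m)) where

  NoArcEnters NoArcLeaves : Subset m → Set
  NoArcEnters S = ∀ {u v} → (u , v) ∈ₗ D → v ∈ S → u ∈ S
  NoArcLeaves R = ∀ {u v} → (u , v) ∈ₗ D → u ∈ R → v ∈ R

  count-entering≡0⇔NoArcEnters : ∀ S → count (entering S) D ≡ 0 ⇔ NoArcEnters S
  count-entering≡0⇔NoArcEnters S = mk⇔ to from
    where
    to : count (entering S) D ≡ 0 → NoArcEnters S
    to none uv = entering≡false⇒ S (count≡0⇒false (entering S) D none uv)
    from : NoArcEnters S → count (entering S) D ≡ 0
    from noEntry = false⇒count≡0 (entering S) D (λ uv → entering≡false⇐ S (noEntry uv))

  NoArcLeaves⇒NoArcEnters∁ : ∀ {R} → NoArcLeaves R → NoArcEnters (∁ R)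
  NoArcLeaves⇒NoArcEnters∁ noExit uv v∈∁R = x∉p⇒x∈∁p (λ u∈R → x∈∁p⇒x∉p v∈∁R (noExit uv u∈R))

  NoArcEnters-∪ : ∀ {S T} → NoArcEnters S → NoArcEnters T → NoArcEnters (S ∪ T)
  NoArcEnters-∪ {S} {T} noEntryS noEntryT uv v∈S∪T with x∈p∪q⁻ S T v∈S∪T
  ... | inj₁ v∈S = p⊆p∪q T (noEntryS uv v∈S)
  ... | inj₂ v∈T = q⊆p∪q S T (noEntryT uv v∈T)

  NoArcEnters-backwards : ∀ {S u v} → NoArcEnters S → DirPath D u v → v ∈ S → u ∈ S
  NoArcEnters-backwards noEntry ε          v∈S = v∈S
  NoArcEnters-backwards noEntry (uw ◅ wv) v∈S = noEntry uw (NoArcEnters-backwards noEntry wv v∈S)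

  arcLeaving? : ∀ R → NoArcLeaves R ⊎ ∃₂ λ u v → (u , v) ∈ₗ D × u ∈ R × v ∉ R
  arcLeaving? R with any? (λ (u , v) → u ∈? R ×-dec ¬? (v ∈? R)) D
  ... | yes leaving = let (u , v) , uv , u∈R , v∉R = find leaving in inj₂ (u , v , uv , u∈R , v∉R)
  ... | no ¬leaving = inj₁ λ {u} {v} uv u∈R →
    decidable-stable (v ∈? R) (λ v∉R → ¬leaving (lose uv (u∈R , v∉R)))

  module _ (q : Fin m) where

    Reaches : Subset m → Set
    Reaches R = ∀ {v} → v ∈ R → DirPath D q v

    Reaches-⁅⁆ : Reaches ⁅ q ⁆
    Reaches-⁅⁆ v∈⁅q⁆ = subst (DirPath D q) (sym (x∈⁅y⁆⇒x≡y q v∈⁅q⁆)) ε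

    Reaches-∪-⁅head⁆ : ∀ {R u v} → Reaches R → (u , v) ∈ₗ D → u ∈ R → Reaches (R ∪ ⁅ v ⁆)
    Reaches-∪-⁅head⁆ {R} {u} {v} reach uv u∈R x∈R∪v with x∈p∪q⁻ R ⁅ v ⁆ x∈R∪v
    ... | inj₁ x∈R = reach x∈R
    ... | inj₂ x∈⁅v⁆ rewrite x∈⁅y⁆⇒x≡y v x∈⁅v⁆ = reach u∈R ◅◅ (uv ◅ ε)

    -- the fuel exceeds the number of vertices still outside R
    reachClosure : ∀ fuel R → m < fuel + ∣ R ∣ → Reaches R →
                   ∃ λ R′ → R ⊆ R′ × Reaches R′ × NoArcLeaves R′
    reachClosure zero R bound _ = contradiction (∣p∣≤n R) (ℕₚ.<⇒≱ bound)
    reachClosure (suc fuel) R bound reach with arcLeaving? R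
    ... | inj₁ noExit = R , (λ x∈R → x∈R) , reach , noExit
    ... | inj₂ (u , v , uv , u∈R , v∉R) =
      let R′ , R∪v⊆R′ , reach′ , noExit = reachClosure fuel (R ∪ ⁅ v ⁆) bound′ (Reaches-∪-⁅head⁆ reach uv u∈R)
      in R′ , R∪v⊆R′ ∘ p⊆p∪q ⁅ v ⁆ , reach′ , noExit
      where
      bound′ : m < fuel + ∣ R ∪ ⁅ v ⁆ ∣
      bound′ = ℕₚ.<-≤-trans bound (subst (_≤ fuel + ∣ R ∪ ⁅ v ⁆ ∣) (ℕₚ.+-suc fuel ∣ R ∣)
                 (ℕₚ.+-monoʳ-≤ fuel (p⊂q⇒∣p∣<∣q∣ (⊂-∪-⁅⁆ v∉R))))

    reachableSet : ∃ λ R → q ∈ R × Reaches R × NoArcLeaves R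
    reachableSet =
      let R , ⁅q⁆⊆R , reach , noExit = reachClosure m ⁅ q ⁆ bound Reaches-⁅⁆
      in R , ⁅q⁆⊆R (x∈⁅x⁆ q) , reach , noExit
      where
      bound : m < m + ∣ ⁅ q ⁆ ∣
      bound = subst (λ k → m < m + k) (sym (∣⁅x⁆∣≡1 q)) (ℕₚ.m<m+n m (s≤s z≤n))

Maximal : ∀ {m} → (Subset m → Set) → Subset m → Set
Maximal P S = P S × (∀ T → P T → S ⊆ T → T ≡ S)

greatest⇒uniqueMaximal : ∀ {m} {P : Subset m → Set} {M} → P M → (∀ {T} → P T → T ⊆ M) →
                         Maximal P M × (∀ M′ → Maximal P M′ → M′ ≡ M)
greatest⇒uniqueMaximal PM greatest =
  (PM , λ T PT M⊆T → ⊆-antisym (greatest PT) M⊆T) ,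
  λ M′ (PM′ , maximal) → sym (maximal _ PM (greatest PM′))

module _ {m : ℕ} (D : List (Fin m × Fin m)) (q : Fin m) where

  Unentered : Subset m → Set
  Unentered S = Nonempty S × q ∉ S × NoArcEnters D S

  Unentered-∪ : ∀ {S T} → Unentered S → Unentered T → Unentered (S ∪ T)
  Unentered-∪ {S} {T} ((x , x∈S) , q∉S , noEntryS) (_ , q∉T , noEntryT) =
    (x , p⊆p∪q T x∈S) , q∉S∪T , NoArcEnters-∪ D noEntryS noEntryT
    where
    q∉S∪T : q ∉ S ∪ T
    q∉S∪T q∈S∪T with x∈p∪q⁻ S T q∈S∪T
    ... | inj₁ q∈S = q∉S q∈S
    ... | inj₂ q∈T = q∉T q∈T

  Unentered⇒⊆∁ : ∀ {S R} → Unentered S → Reaches D q R → S ⊆ ∁ R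
  Unentered⇒⊆∁ (_ , q∉S , noEntry) reach x∈S =
    x∉p⇒x∈∁p (λ x∈R → q∉S (NoArcEnters-backwards D noEntry (reach x∈R) x∈S))

module _ (G : Multigraph) {E D} (realizes : Realizes G E D) where

  0≤χ : ∀ S → 0ℤ ℤ.≤ χ G S E
  0≤χ S = subst (0ℤ ℤ.≤_) (sym (χ≡entering G realizes S)) (+≤+ z≤n)

  χ≡0⇔NoArcEnters : ∀ S → χ G S E ≡ 0ℤ ⇔ NoArcEnters D S
  χ≡0⇔NoArcEnters S = mk⇔
    (Equivalence.to (count-entering≡0⇔NoArcEnters D S) ∘ ℤₚ.+-injective ∘ trans (sym (χ≡entering G realizes S)))
    (trans (χ≡entering G realizes S) ∘ cong +_ ∘ Equivalence.from (count-entering≡0⇔NoArcEnters D S))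

  -- an unentered set M has χ(M,E) = 0, so χ_E = 0
  InSq⇔Unentered : ∀ q {M} → Unentered D q M → ∀ S → InSq G q E S ⇔ Unentered D q S
  InSq⇔Unentered q {M} (nonemptyM , q∉M , noEntryM) S = mk⇔ to from
    where
    to : InSq G q E S → Unentered D q S
    to (nonempty , q∉S , _ , minimal) = nonempty , q∉S ,
      Equivalence.to (χ≡0⇔NoArcEnters S)
        (ℤₚ.≤-antisym (subst (χ G S E ℤ.≤_) (Equivalence.from (χ≡0⇔NoArcEnters M) noEntryM)
                                            (minimal M (nonemptyM , q , q∉M)))
                      (0≤χ S))
    from : Unentered D q S → InSq G q E S
    from (nonempty , q∉S , noEntry) = nonempty , q∉S , (nonempty , q , q∉S) ,
      λ T _ → subst (ℤ._≤ χ G T E) (sym (Equivalence.from (χ≡0⇔NoArcEnters S) noEntry)) (0≤χ T)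

lemma4p9 : (G : Multigraph) → Connected G → (q : Fin (n G)) → (E : Div G)
         → Orientable G E → ¬ QOrientable G q E
         → (∀ S₁ S₂ → InSq G q E S₁ → InSq G q E S₂ → InSq G q E (S₁ ∪ S₂))
           × (∃ λ M → MaximalInSq G q E M × (∀ M′ → MaximalInSq G q E M′ → M′ ≡ M))
lemma4p9 G _ q E (D , realizes) notQOrientable with reachableSet D q
... | R , q∈R , reach , noExit =
  (λ S₁ S₂ S₁∈Sq S₂∈Sq → fromUnentered (Unentered-∪ D q (toUnentered S₁∈Sq) (toUnentered S₂∈Sq))) ,
  ∁ R , greatest⇒uniqueMaximal (fromUnentered unentered∁R) (λ T∈Sq → Unentered⇒⊆∁ D q (toUnentered T∈Sq) reach)
  where
  nonempty∁R : Nonempty (∁ R)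
  nonempty∁R with nonempty? (∁ R)
  ... | yes nonempty = nonempty
  ... | no empty = contradiction (D , realizes , reach ∘ everyVertexInR) notQOrientable
    where
    everyVertexInR : ∀ v → v ∈ R
    everyVertexInR v = decidable-stable (v ∈? R) (λ v∉R → empty (v , x∉p⇒x∈∁p v∉R))

  unentered∁R : Unentered D q (∁ R)
  unentered∁R = nonempty∁R , x∈p⇒x∉∁p q∈R , NoArcLeaves⇒NoArcEnters∁ D noExit

  toUnentered : ∀ {S} → InSq G q E S → Unentered D q S
  toUnentered {S} = Equivalence.to (InSq⇔Unentered G realizes q unentered∁R S)

  fromUnentered : ∀ {S} → Unentered D q S → InSq G q E S
  fromUnentered {S} = Equivalence.from (InSq⇔Unentered G realizes q unentered∁R S)
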